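{- Let $\mathbf{A}=\{A_1,\dots,A_N\}$ and $\mathbf{B}=\{B_1,\dots,B_K\}$ be disjoint finite sets of propositional atoms, let $\psi$ be a formula over $\mathbf{A}\cup\mathbf{B}$, and let $\mu$ be a partial truth assignment on $\mathbf{A}$. Then $\mu\vdash\exists\mathbf{B}.\psi$ iff $\mu\vdash \mathrm{Sh}_{\mathbf{B}}(\psi)$.
   Context: A partial truth assignment on a set of atoms is a map from a subset of it to $\{\mathsf{true},\mathsf{false}\}$, identified with a set of literals; it is total if defined on the whole set. The residual $\varphi|_\mu$ is obtained by substituting each atom assigned by $\mu$ with $\top$ or $\bot$ and exhaustively simplifying with the rules $\neg\top\Rightarrow\bot$, $\neg\bot\Rightarrow\top$, $\top\wedge\chi,\chi\wedge\top\Rightarrow\chi$, $\bot\wedge\chi,\chi\wedge\bot\Rightarrow\bot$, $\top\vee\chi,\chi\vee\top\Rightarrow\top$, $\bot\vee\chi,\chi\vee\bot\Rightarrow\chi$, $\top\to\chi\Rightarrow\chi$, $\bot\to\chi\Rightarrow\top$, $\chi\to\top\Rightarrow\top$, $\chi\to\bot\Rightarrow\neg\chi$, $\top\leftrightarrow\chi,\chi\leftrightarrow\top\Rightarrow\chi$, $\bot\leftrightarrow\chi,\chi\leftrightarrow\bot\Rightarrow\neg\chi$. For a propositional formula $\varphi$, $\mu\vdash\varphi$ ($\mu$ validates $\varphi$) means $\varphi|_\mu=\top$ (equivalently, $\mu$ evaluates $\varphi$ to true in Kleene's strong three-valued semantics with unassigned atoms unknown). The Shannon expansion is the formula over $\mathbf{A}$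 given by $\mathrm{Sh}_{\mathbf{B}}(\psi)=\bigvee_{\delta}\psi|_\delta$, the disjunction ranging over all $2^K$ total truth assignments $\delta$ on $\mathbf{B}$. By definition, $\mu$ validates $\exists\mathbf{B}.\psi$, written $\mu\vdash\exists\mathbf{B}.\psi$, iff there exists a total truth assignment $\delta$ on $\mathbf{B}$ with $\mu\cup\delta\vdash\psi$. -}

module Defs where

open import Data.Bool using (Bool; true; false)
open import Data.Nat using (ℕ; zero; suc)
open import Data.Fin using (Fin; zero; suc)
open import Data.Maybe using (Maybe; just; nothing)
open import Data.Sum using (_⊎_; inj₁; inj₂)
open import Data.List using (List; []; _∷_; map; _++_)
open import Data.Product using (∃)
open import Relation.Binary.PropositionalEquality using (_≡_)

data Formula (X : Set) : Set where
  ⊤f ⊥f : Formula X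
  atom  : X → Formula X
  ¬f_   : Formula X → Formula X
  _∧f_ _∨f_ _⇒f_ _⇔f_ : Formula X → Formula X → Formula X

-- Smart constructors implementing the simplification rules of the paper
-- (applied bottom-up, this yields the exhaustive simplification).
neg : ∀ {X} → Formula X → Formula X
neg ⊤f = ⊥f
neg ⊥f = ⊤f
neg χ  = ¬f χ

and : ∀ {X} → Formula X → Formula X → Formula X
and ⊤f χ  = χ
and ⊥f χ  = ⊥f
and χ  ⊤f = χ
and χ  ⊥f = ⊥f
and χ  ξ  = χ ∧f ξ

or : ∀ {X} → Formula X → Formula X → Formula X
or ⊤f χ  = ⊤f
or ⊥f χ  = χ
or χ  ⊤f = ⊤f
or χ  ⊥f = χ
or χ  ξ  = χ ∨f ξ

imp : ∀ {X} → Formula X → Formula X → Formula X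
imp ⊤f χ  = χ
imp ⊥f χ  = ⊤f
imp χ  ⊤f = ⊤f
imp χ  ⊥f = neg χ
imp χ  ξ  = χ ⇒f ξ

iff : ∀ {X} → Formula X → Formula X → Formula X
iff ⊤f χ  = χ
iff ⊥f χ  = neg χ
iff χ  ⊤f = χ
iff χ  ⊥f = neg χ
iff χ  ξ  = χ ⇔f ξ

const : ∀ {X} → Bool → Formula X
const true  = ⊤f
const false = ⊥f

instantiate : ∀ {X Y} → (X → Y ⊎ Bool) → Formula X → Formula Y
instantiate σ ⊤f = ⊤f
instantiate σ ⊥f = ⊥f
instantiate σ (atom x) with σ x
... | inj₁ y = atom y
... | inj₂ b = const b
instantiate σ (¬f φ)    = neg (instantiate σ φ)
instantiate σ (φ ∧f ξ)  = and (instantiate σ φ) (instantiate σ ξ)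
instantiate σ (φ ∨f ξ)  = or  (instantiate σ φ) (instantiate σ ξ)
instantiate σ (φ ⇒f ξ)  = imp (instantiate σ φ) (instantiate σ ξ)
instantiate σ (φ ⇔f ξ)  = iff (instantiate σ φ) (instantiate σ ξ)

PartialAssignment : Set → Set
PartialAssignment X = X → Maybe Bool

residual : ∀ {X} → Formula X → PartialAssignment X → Formula X
residual φ μ = instantiate (λ x → lift (μ x) x) φ
  where
  lift : ∀ {X} → Maybe Bool → X → X ⊎ Bool
  lift (just b) x = inj₂ b
  lift nothing  x = inj₁ x

_⊢_ : ∀ {X} → PartialAssignment X → Formula X → Set
μ ⊢ φ = residual φ μ ≡ ⊤f

-- A = {A_1..A_N} as Fin N, B = {B_1..B_K} as Fin K; A ∪ B (disjoint) as Fin N ⊎ Fin K.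

residualB : ∀ {N K} → Formula (Fin N ⊎ Fin K) → (Fin K → Bool) → Formula (Fin N)
residualB ψ δ = instantiate σ ψ
  where
  σ : _ → _
  σ (inj₁ a) = inj₁ a
  σ (inj₂ b) = inj₂ (δ b)

allAssignments : (K : ℕ) → List (Fin K → Bool)
allAssignments zero = (λ ()) ∷ []
allAssignments (suc K) =
  map (λ δ → cons true δ) (allAssignments K) ++ map (λ δ → cons false δ) (allAssignments K)
  where
  cons : Bool → (Fin K → Bool) → Fin (suc K) → Bool
  cons b δ zero    = b
  cons b δ (suc i) = δ i

⋁ : ∀ {X} → List (Formula X) → Formula X
⋁ []       = ⊥f
⋁ (φ ∷ []) = φ
⋁ (φ ∷ φs) = φ ∨f ⋁ φs

Sh : ∀ {N K} → Formula (Fin N ⊎ Fin K) → Formula (Fin N)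
Sh {N} {K} ψ = ⋁ (map (residualB ψ) (allAssignments K))

_∪_ : ∀ {N K} → PartialAssignment (Fin N) → (Fin K → Bool) → PartialAssignment (Fin N ⊎ Fin K)
(μ ∪ δ) (inj₁ a) = μ a
(μ ∪ δ) (inj₂ b) = just (δ b)

_⊢∃B_ : ∀ {N K} → PartialAssignment (Fin N) → Formula (Fin N ⊎ Fin K) → Set
_⊢∃B_ {N} {K} μ ψ = ∃ λ (δ : Fin K → Bool) → (μ ∪ δ) ⊢ ψ

-- Substituting σ and then τ, simplifying after each step, yields the same
-- formula as substituting the composite substitution at once: every
-- simplifying constructor commutes with instantiation.  Hence (ψ|δ)|μ and
-- ψ|(μ ∪ δ) are the same formula up to renaming the atoms of A, so
-- μ ⊢ ψ|δ iff μ ∪ δ ⊢ ψ.  Finally μ validates a disjunction iff it validates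
-- one of its disjuncts, because or χ ξ simplifies to ⊤ only when χ or ξ does,
-- and every total assignment on B is enumerated by allAssignments.
module Submission where

open import Data.Bool using (Bool; true; false)
open import Data.Fin using (Fin; zero; suc)
open import Data.List using (List; []; _∷_; map)
open import Data.List.Relation.Unary.Any as Any using (Any; here; there)
open import Data.List.Relation.Unary.Any.Properties using (map⁻; gmap; ++⁺ˡ; ++⁺ʳ)
open import Data.Maybe using (Maybe; just; nothing)
open import Data.Nat using (ℕ; zero; suc)
open import Data.Product using (_,_)
open import Data.Sum using (_⊎_; inj₁; inj₂; [_,_]′)
open import Function.Base using (_∘_)
open import Function.Bundles using (_⇔_; mk⇔; Equivalence)
open import Relation.Binary.PropositionalEquality
  using (_≡_; refl; sym; trans; cong; cong₂; _≗_; module ≡-Reasoning)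
open ≡-Reasoning

open import Defs

private
  variable
    X Y Z : Set

data Compound {X : Set} : Formula X → Set where
  atom : ∀ x → Compound (atom x)
  ¬f_  : ∀ φ → Compound (¬f φ)
  _∧f_ : ∀ φ ξ → Compound (φ ∧f ξ)
  _∨f_ : ∀ φ ξ → Compound (φ ∨f ξ)
  _⇒f_ : ∀ φ ξ → Compound (φ ⇒f ξ)
  _⇔f_ : ∀ φ ξ → Compound (φ ⇔f ξ)

data Shape {X : Set} : Formula X → Set where
  ⊤-shape  : Shape ⊤f
  ⊥-shape  : Shape ⊥f
  compound : ∀ {φ} → Compound φ → Shape φ

shape : (φ : Formula X) → Shape φ
shape ⊤f       = ⊤-shape
shape ⊥f       = ⊥-shape
shape (atom x) = compound (atom x)
shape (¬f φ)   = compound (¬f φ)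
shape (φ ∧f ξ) = compound (φ ∧f ξ)
shape (φ ∨f ξ) = compound (φ ∨f ξ)
shape (φ ⇒f ξ) = compound (φ ⇒f ξ)
shape (φ ⇔f ξ) = compound (φ ⇔f ξ)

-- The simplifying constructors state these rules only for a non-constant
-- left argument; they hold for constant ones too, the rule applied first
-- giving the same result.
record RightConstantLaws (χ : Formula X) : Set where
  constructor rightConstantLaws
  field
    and-⊤ʳ : and χ ⊤f ≡ χ
    and-⊥ʳ : and χ ⊥f ≡ ⊥f
    or-⊤ʳ  : or χ ⊤f ≡ ⊤f
    or-⊥ʳ  : or χ ⊥f ≡ χ
    imp-⊤ʳ : imp χ ⊤f ≡ ⊤f
    imp-⊥ʳ : imp χ ⊥f ≡ neg χ
    iff-⊤ʳ : iff χ ⊤f ≡ χ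
    iff-⊥ʳ : iff χ ⊥f ≡ neg χ

right-constant-laws : (χ : Formula X) → RightConstantLaws χ
right-constant-laws ⊤f       = rightConstantLaws refl refl refl refl refl refl refl refl
right-constant-laws ⊥f       = rightConstantLaws refl refl refl refl refl refl refl refl
right-constant-laws (atom _) = rightConstantLaws refl refl refl refl refl refl refl refl
right-constant-laws (¬f _)   = rightConstantLaws refl refl refl refl refl refl refl refl
right-constant-laws (_ ∧f _) = rightConstantLaws refl refl refl refl refl refl refl refl
right-constant-laws (_ ∨f _) = rightConstantLaws refl refl refl refl refl refl refl refl
right-constant-laws (_ ⇒f _) = rightConstantLaws refl refl refl refl refl refl refl refl
right-constant-laws (_ ⇔f _) = rightConstantLaws refl refl refl refl refl refl refl refl

module _ (χ : Formula X) where
  open RightConstantLaws (right-constant-laws χ) public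

record CompoundLaws (φ ξ : Formula X) : Set where
  constructor compoundLaws
  field
    and-compound : and φ ξ ≡ φ ∧f ξ
    or-compound  : or φ ξ ≡ φ ∨f ξ
    imp-compound : imp φ ξ ≡ φ ⇒f ξ
    iff-compound : iff φ ξ ≡ φ ⇔f ξ

compound-laws : {φ ξ : Formula X} → Compound φ → Compound ξ → CompoundLaws φ ξ
compound-laws (atom _)   (atom _)   = compoundLaws refl refl refl refl
compound-laws (atom _)   (¬f _)     = compoundLaws refl refl refl refl
compound-laws (atom _)   (_ ∧f _)   = compoundLaws refl refl refl refl
compound-laws (atom _)   (_ ∨f _)   = compoundLaws refl refl refl refl
compound-laws (atom _)   (_ ⇒f _)   = compoundLaws refl refl refl refl
compound-laws (atom _)   (_ ⇔f _)   = compoundLaws refl refl refl refl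
compound-laws (¬f _)     (atom _)   = compoundLaws refl refl refl refl
compound-laws (¬f _)     (¬f _)     = compoundLaws refl refl refl refl
compound-laws (¬f _)     (_ ∧f _)   = compoundLaws refl refl refl refl
compound-laws (¬f _)     (_ ∨f _)   = compoundLaws refl refl refl refl
compound-laws (¬f _)     (_ ⇒f _)   = compoundLaws refl refl refl refl
compound-laws (¬f _)     (_ ⇔f _)   = compoundLaws refl refl refl refl
compound-laws (_ ∧f _)   (atom _)   = compoundLaws refl refl refl refl
compound-laws (_ ∧f _)   (¬f _)     = compoundLaws refl refl refl refl
compound-laws (_ ∧f _)   (_ ∧f _)   = compoundLaws refl refl refl refl
compound-laws (_ ∧f _)   (_ ∨f _)   = compoundLaws refl refl refl refl
compound-laws (_ ∧f _)   (_ ⇒f _)   = compoundLaws refl refl refl refl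
compound-laws (_ ∧f _)   (_ ⇔f _)   = compoundLaws refl refl refl refl
compound-laws (_ ∨f _)   (atom _)   = compoundLaws refl refl refl refl
compound-laws (_ ∨f _)   (¬f _)     = compoundLaws refl refl refl refl
compound-laws (_ ∨f _)   (_ ∧f _)   = compoundLaws refl refl refl refl
compound-laws (_ ∨f _)   (_ ∨f _)   = compoundLaws refl refl refl refl
compound-laws (_ ∨f _)   (_ ⇒f _)   = compoundLaws refl refl refl refl
compound-laws (_ ∨f _)   (_ ⇔f _)   = compoundLaws refl refl refl refl
compound-laws (_ ⇒f _)   (atom _)   = compoundLaws refl refl refl refl
compound-laws (_ ⇒f _)   (¬f _)     = compoundLaws refl refl refl refl
compound-laws (_ ⇒f _)   (_ ∧f _)   = compoundLaws refl refl refl refl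
compound-laws (_ ⇒f _)   (_ ∨f _)   = compoundLaws refl refl refl refl
compound-laws (_ ⇒f _)   (_ ⇒f _)   = compoundLaws refl refl refl refl
compound-laws (_ ⇒f _)   (_ ⇔f _)   = compoundLaws refl refl refl refl
compound-laws (_ ⇔f _)   (atom _)   = compoundLaws refl refl refl refl
compound-laws (_ ⇔f _)   (¬f _)     = compoundLaws refl refl refl refl
compound-laws (_ ⇔f _)   (_ ∧f _)   = compoundLaws refl refl refl refl
compound-laws (_ ⇔f _)   (_ ∨f _)   = compoundLaws refl refl refl refl
compound-laws (_ ⇔f _)   (_ ⇒f _)   = compoundLaws refl refl refl refl
compound-laws (_ ⇔f _)   (_ ⇔f _)   = compoundLaws refl refl refl refl

open CompoundLaws

module _ (τ : X → Y ⊎ Bool) where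

  instantiate-neg : (φ : Formula X) → instantiate τ (neg φ) ≡ neg (instantiate τ φ)
  instantiate-neg ⊤f       = refl
  instantiate-neg ⊥f       = refl
  instantiate-neg (atom _) = refl
  instantiate-neg (¬f _)   = refl
  instantiate-neg (_ ∧f _) = refl
  instantiate-neg (_ ∨f _) = refl
  instantiate-neg (_ ⇒f _) = refl
  instantiate-neg (_ ⇔f _) = refl

  instantiate-and : (φ ξ : Formula X) →
                    instantiate τ (and φ ξ) ≡ and (instantiate τ φ) (instantiate τ ξ)
  instantiate-and φ ξ with shape φ | shape ξ
  ... | ⊤-shape    | _          = refl
  ... | ⊥-shape    | _          = refl
  ... | compound _ | ⊤-shape    =
    trans (cong (instantiate τ) (and-⊤ʳ φ)) (sym (and-⊤ʳ (instantiate τ φ)))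
  ... | compound _ | ⊥-shape    =
    trans (cong (instantiate τ) (and-⊥ʳ φ)) (sym (and-⊥ʳ (instantiate τ φ)))
  ... | compound p | compound q = cong (instantiate τ) (and-compound (compound-laws p q))

  instantiate-or : (φ ξ : Formula X) →
                   instantiate τ (or φ ξ) ≡ or (instantiate τ φ) (instantiate τ ξ)
  instantiate-or φ ξ with shape φ | shape ξ
  ... | ⊤-shape    | _          = refl
  ... | ⊥-shape    | _          = refl
  ... | compound _ | ⊤-shape    =
    trans (cong (instantiate τ) (or-⊤ʳ φ)) (sym (or-⊤ʳ (instantiate τ φ)))
  ... | compound _ | ⊥-shape    =
    trans (cong (instantiate τ) (or-⊥ʳ φ)) (sym (or-⊥ʳ (instantiate τ φ)))
  ... | compound p | compound q = cong (instantiate τ) (or-compound (compound-laws p q))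

  instantiate-imp : (φ ξ : Formula X) →
                    instantiate τ (imp φ ξ) ≡ imp (instantiate τ φ) (instantiate τ ξ)
  instantiate-imp φ ξ with shape φ | shape ξ
  ... | ⊤-shape    | _          = refl
  ... | ⊥-shape    | _          = refl
  ... | compound _ | ⊤-shape    =
    trans (cong (instantiate τ) (imp-⊤ʳ φ)) (sym (imp-⊤ʳ (instantiate τ φ)))
  ... | compound _ | ⊥-shape    =
    trans (cong (instantiate τ) (imp-⊥ʳ φ))
          (trans (instantiate-neg φ) (sym (imp-⊥ʳ (instantiate τ φ))))
  ... | compound p | compound q = cong (instantiate τ) (imp-compound (compound-laws p q))

  instantiate-iff : (φ ξ : Formula X) →
                    instantiate τ (iff φ ξ) ≡ iff (instantiate τ φ) (instantiate τ ξ)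
  instantiate-iff φ ξ with shape φ | shape ξ
  ... | ⊤-shape    | _          = refl
  ... | ⊥-shape    | _          = instantiate-neg ξ
  ... | compound _ | ⊤-shape    =
    trans (cong (instantiate τ) (iff-⊤ʳ φ)) (sym (iff-⊤ʳ (instantiate τ φ)))
  ... | compound _ | ⊥-shape    =
    trans (cong (instantiate τ) (iff-⊥ʳ φ))
          (trans (instantiate-neg φ) (sym (iff-⊥ʳ (instantiate τ φ))))
  ... | compound p | compound q = cong (instantiate τ) (iff-compound (compound-laws p q))

  instantiate-const : (b : Bool) → instantiate τ (const b) ≡ const b
  instantiate-const true  = refl
  instantiate-const false = refl

instantiate-instantiate :
  (σ : X → Y ⊎ Bool) (τ : Y → Z ⊎ Bool) (ρ : X → Z ⊎ Bool) →
  (∀ x → instantiate τ (instantiate σ (atom x)) ≡ instantiate ρ (atom x)) →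
  ∀ φ → instantiate τ (instantiate σ φ) ≡ instantiate ρ φ
instantiate-instantiate σ τ ρ onAtoms = go
  where
  go : ∀ φ → instantiate τ (instantiate σ φ) ≡ instantiate ρ φ
  go ⊤f       = refl
  go ⊥f       = refl
  go (atom x) = onAtoms x
  go (¬f φ)   = trans (instantiate-neg τ (instantiate σ φ)) (cong neg (go φ))
  go (φ ∧f ξ) = trans (instantiate-and τ (instantiate σ φ) (instantiate σ ξ))
                      (cong₂ and (go φ) (go ξ))
  go (φ ∨f ξ) = trans (instantiate-or τ (instantiate σ φ) (instantiate σ ξ))
                      (cong₂ or (go φ) (go ξ))
  go (φ ⇒f ξ) = trans (instantiate-imp τ (instantiate σ φ) (instantiate σ ξ))
                      (cong₂ imp (go φ) (go ξ))
  go (φ ⇔f ξ) = trans (instantiate-iff τ (instantiate σ φ) (instantiate σ ξ))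
                      (cong₂ iff (go φ) (go ξ))

literal : Y ⊎ Bool → Formula Y
literal = [ atom , const ]′

instantiate-atom : (σ : X → Y ⊎ Bool) (x : X) → instantiate σ (atom x) ≡ literal (σ x)
instantiate-atom σ x with σ x
... | inj₁ _ = refl
... | inj₂ _ = refl

valueOrAtom : Maybe Bool → X → X ⊎ Bool
valueOrAtom (just b) x = inj₂ b
valueOrAtom nothing  x = inj₁ x

residual-atom : (μ : PartialAssignment X) (x : X) →
                residual (atom x) μ ≡ literal (valueOrAtom (μ x) x)
residual-atom μ x with μ x
... | just _  = refl
... | nothing = refl

instantiate-valueOrAtom : (σ : X → Y ⊎ Bool) {x : X} {y : Y} (m : Maybe Bool) →
                          σ x ≡ inj₁ y →
                          instantiate σ (literal (valueOrAtom m x)) ≡ literal (valueOrAtom m y)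
instantiate-valueOrAtom σ     (just b) _    = instantiate-const σ b
instantiate-valueOrAtom σ {x} nothing  σx≡y = trans (instantiate-atom σ x) (cong literal σx≡y)

or-≡⊤ : (χ ξ : Formula X) → or χ ξ ≡ ⊤f → χ ≡ ⊤f ⊎ ξ ≡ ⊤f
or-≡⊤ χ ξ eq with shape χ | shape ξ
... | ⊤-shape    | _          = inj₁ refl
... | ⊥-shape    | _          = inj₂ eq
... | compound _ | ⊤-shape    = inj₂ refl
... | compound _ | ⊥-shape    = inj₁ (trans (sym (or-⊥ʳ χ)) eq)
... | compound p | compound q with trans (sym (or-compound (compound-laws p q))) eq
...   | ()

⊢-⋁ : (μ : PartialAssignment X) (φs : List (Formula X)) → μ ⊢ ⋁ φs ⇔ Any (μ ⊢_) φs
⊢-⋁ μ φs = mk⇔ (to φs) (from φs)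
  where
  to : ∀ φs → μ ⊢ ⋁ φs → Any (μ ⊢_) φs
  to []           ()
  to (φ ∷ [])     ⊢φ  = here ⊢φ
  to (φ ∷ ξ ∷ φs) ⊢∨ =
    [ here , there ∘ to (ξ ∷ φs) ]′ (or-≡⊤ (residual φ μ) (residual (⋁ (ξ ∷ φs)) μ) ⊢∨)

  from : ∀ φs → Any (μ ⊢_) φs → μ ⊢ ⋁ φs
  from (φ ∷ [])     (here ⊢φ)   = ⊢φ
  from (φ ∷ ξ ∷ φs) (here ⊢φ)   = cong (λ χ → or χ (residual (⋁ (ξ ∷ φs)) μ)) ⊢φ
  from (φ ∷ ξ ∷ φs) (there ⊢φs) =
    trans (cong (or (residual φ μ)) (from (ξ ∷ φs) ⊢φs)) (or-⊤ʳ (residual φ μ))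

module _ {N K : ℕ} where

  _∪ᴬ_ : PartialAssignment (Fin N) → (Fin K → Bool) → Fin N ⊎ Fin K → Fin N ⊎ Bool
  (μ ∪ᴬ δ) (inj₁ a) = valueOrAtom (μ a) a
  (μ ∪ᴬ δ) (inj₂ b) = inj₂ (δ b)

  embed : Fin N → (Fin N ⊎ Fin K) ⊎ Bool
  embed a = inj₁ (inj₁ a)

  -- The value given to the atoms of B is irrelevant: none occurs in ψ|(μ ∪ δ).
  retract : Fin N ⊎ Fin K → Fin N ⊎ Bool
  retract (inj₁ a) = inj₁ a
  retract (inj₂ _) = inj₂ false

module _ {N K : ℕ} (μ : PartialAssignment (Fin N)) (ψ : Formula (Fin N ⊎ Fin K)) where

  residual-residualB : {δ′ δ : Fin K → Bool} → δ′ ≗ δ →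
                       residual (residualB ψ δ′) μ ≡ instantiate (μ ∪ᴬ δ) ψ
  residual-residualB {δ′} {δ} δ′≗δ = instantiate-instantiate _ _ (μ ∪ᴬ δ) onAtoms ψ
    where
    onAtoms : ∀ x → residual (residualB (atom x) δ′) μ ≡ instantiate (μ ∪ᴬ δ) (atom x)
    onAtoms (inj₁ a) = trans (residual-atom μ a) (sym (instantiate-atom (μ ∪ᴬ δ) (inj₁ a)))
    onAtoms (inj₂ b) = trans (instantiate-const _ (δ′ b)) (cong const (δ′≗δ b))

  residual-∪ : (δ : Fin K → Bool) →
               residual ψ (μ ∪ δ) ≡ instantiate embed (instantiate (μ ∪ᴬ δ) ψ)
  residual-∪ δ = sym (instantiate-instantiate (μ ∪ᴬ δ) embed _ onAtoms ψ)
    where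
    onAtoms : ∀ x → instantiate embed (instantiate (μ ∪ᴬ δ) (atom x)) ≡ residual (atom x) (μ ∪ δ)
    onAtoms (inj₁ a) = begin
      instantiate embed (instantiate (μ ∪ᴬ δ) (atom (inj₁ a)))
        ≡⟨ cong (instantiate embed) (instantiate-atom (μ ∪ᴬ δ) (inj₁ a)) ⟩
      instantiate embed (literal (valueOrAtom (μ a) a))
        ≡⟨ instantiate-valueOrAtom embed (μ a) refl ⟩
      literal (valueOrAtom (μ a) (inj₁ a))
        ≡⟨ sym (residual-atom (μ ∪ δ) (inj₁ a)) ⟩
      residual (atom (inj₁ a)) (μ ∪ δ)
        ∎
    onAtoms (inj₂ b) = instantiate-const embed (δ b)

  retract-residual-∪ : (δ : Fin K → Bool) →
                       instantiate retract (residual ψ (μ ∪ δ)) ≡ instantiate (μ ∪ᴬ δ) ψ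
  retract-residual-∪ δ = instantiate-instantiate _ retract (μ ∪ᴬ δ) onAtoms ψ
    where
    onAtoms : ∀ x → instantiate retract (residual (atom x) (μ ∪ δ)) ≡ instantiate (μ ∪ᴬ δ) (atom x)
    onAtoms (inj₁ a) = begin
      instantiate retract (residual (atom (inj₁ a)) (μ ∪ δ))
        ≡⟨ cong (instantiate retract) (residual-atom (μ ∪ δ) (inj₁ a)) ⟩
      instantiate retract (literal (valueOrAtom (μ a) (inj₁ a)))
        ≡⟨ instantiate-valueOrAtom retract (μ a) refl ⟩
      literal (valueOrAtom (μ a) a)
        ≡⟨ sym (instantiate-atom (μ ∪ᴬ δ) (inj₁ a)) ⟩
      instantiate (μ ∪ᴬ δ) (atom (inj₁ a))
        ∎
    onAtoms (inj₂ b) = instantiate-const retract (δ b)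

  ⊢residualB⇔⊢∪ : {δ′ δ : Fin K → Bool} → δ′ ≗ δ → μ ⊢ residualB ψ δ′ ⇔ (μ ∪ δ) ⊢ ψ
  ⊢residualB⇔⊢∪ {δ′} {δ} δ′≗δ = mk⇔ to from
    where
    to : μ ⊢ residualB ψ δ′ → (μ ∪ δ) ⊢ ψ
    to ⊢ψδ′ = begin
      residual ψ (μ ∪ δ)
        ≡⟨ residual-∪ δ ⟩
      instantiate embed (instantiate (μ ∪ᴬ δ) ψ)
        ≡⟨ cong (instantiate embed) (residual-residualB δ′≗δ) ⟨
      instantiate embed (residual (residualB ψ δ′) μ)
        ≡⟨ cong (instantiate embed) ⊢ψδ′ ⟩
      ⊤f
        ∎

    from : (μ ∪ δ) ⊢ ψ → μ ⊢ residualB ψ δ′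
    from ⊢ψ = begin
      residual (residualB ψ δ′) μ
        ≡⟨ residual-residualB δ′≗δ ⟩
      instantiate (μ ∪ᴬ δ) ψ
        ≡⟨ retract-residual-∪ δ ⟨
      instantiate retract (residual ψ (μ ∪ δ))
        ≡⟨ cong (instantiate retract) ⊢ψ ⟩
      ⊤f
        ∎

allAssignments-complete : ∀ K (δ : Fin K → Bool) → Any (_≗ δ) (allAssignments K)
allAssignments-complete zero    δ = here (λ ())
allAssignments-complete (suc K) δ with δ zero in δ₀
... | true  = ++⁺ˡ (gmap (λ d≗ → λ { zero → sym δ₀ ; (suc i) → d≗ i })
                         (allAssignments-complete K (δ ∘ suc)))
... | false = ++⁺ʳ _ (gmap (λ d≗ → λ { zero → sym δ₀ ; (suc i) → d≗ i })
                           (allAssignments-complete K (δ ∘ suc)))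

mainTheorem5 : (N K : ℕ) (ψ : Formula (Fin N ⊎ Fin K)) (μ : PartialAssignment (Fin N)) →
                 (μ ⊢∃B ψ) ⇔ (μ ⊢ Sh ψ)
mainTheorem5 N K ψ μ = mk⇔ to from
  where
  ⊢Sh⇔ : μ ⊢ Sh ψ ⇔ Any (μ ⊢_) (map (residualB ψ) (allAssignments K))
  ⊢Sh⇔ = ⊢-⋁ μ (map (residualB ψ) (allAssignments K))

  to : μ ⊢∃B ψ → μ ⊢ Sh ψ
  to (δ , ⊢ψ) = Equivalence.from ⊢Sh⇔ (gmap (λ δ′≗δ → Equivalence.from (⊢residualB⇔⊢∪ μ ψ δ′≗δ) ⊢ψ)
                                             (allAssignments-complete K δ))

  from : μ ⊢ Sh ψ → μ ⊢∃B ψ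
  from ⊢Sh =
    let δ , ⊢ψδ = Any.satisfied (map⁻ (Equivalence.to ⊢Sh⇔ ⊢Sh))
    in δ , Equivalence.to (⊢residualB⇔⊢∪ μ ψ (λ _ → refl)) ⊢ψδ
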